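{- (1) An s-hypersequent $\alpha_1\vdash\beta_1\mid\dots\mid\alpha_n\vdash\beta_n$ is provable in $\mathbf{MPDBL}$ if and only if it is valid in the class of all pure double Boolean algebras with operators. (2) An s-hypersequent $\alpha_1\vdash\beta_1\mid\dots\mid\alpha_n\vdash\beta_n$ is provable in $\mathbf{MPDBL4}$ if and only if it is valid in the class of all topological pure double Boolean algebras.
   Context: Pure double Boolean algebras. A double Boolean algebra is an algebra $\mathbf{D}=(D,\sqcup,\sqcap,\neg,\lrcorner,\top,\bot)$ such that, writing $x\vee y:=\neg(\neg x\sqcap\neg y)$ and $x\wedge y:=\lrcorner(\lrcorner x\sqcup\lrcorner y)$, for all $x,y,z$: $(x\sqcap x)\sqcap y=x\sqcap y$; $(x\sqcup x)\sqcup y=x\sqcup y$; $\sqcap,\sqcup$ commutative and associative; $\neg(x\sqcap x)=\neg x$; $\lrcorner(x\sqcup x)=\lrcorner x$; $x\sqcap(x\sqcup y)=x\sqcap x$; $x\sqcup(x\sqcap y)=x\sqcup x$; $x\sqcap(y\vee z)=(x\sqcap y)\vee(x\sqcap z)$; $x\sqcup(y\wedge z)=(x\sqcup y)\wedge(x\sqcup z)$; $x\sqcap(x\vee y)=x\sqcap x$; $x\sqcup(x\wedge y)=x\sqcup x$; $\neg\neg(x\sqcap y)=x\sqcap y$; $\lrcorner\lrcorner(x\sqcup y)=x\sqcup y$; $x\sqcap\neg x=\bot$; $x\sqcup\lrcorner x=\top$; $\neg\bot=\top\sqcap\top$; $\lrcorner\top=\bot\sqcup\bot$; $\neg\top=\bot$;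 $\lrcorner\bot=\top$; $(x\sqcap x)\sqcup(x\sqcap x)=(x\sqcup x)\sqcap(x\sqcup x)$. It is pure (pdBa) if each $x$ satisfies $x\sqcap x=x$ or $x\sqcup x=x$. $D_\sqcap=\{x:x\sqcap x=x\}$, $D_\sqcup=\{x:x\sqcup x=x\}$; $x\sqsubseteq y$ iff $x\sqcap y=x\sqcap x$ and $x\sqcup y=y\sqcup y$. A pdBa with operators (pdBao) is a pdBa with two maps $\mathbf{I},\mathbf{C}:D\to D$, monotone w.r.t. $\sqsubseteq$, such that $\mathbf{I}(x\sqcap y)=\mathbf{I}(x)\sqcap\mathbf{I}(y)$, $\mathbf{C}(x\sqcup y)=\mathbf{C}(x)\sqcup\mathbf{C}(y)$, $\mathbf{I}(\neg\bot)=\neg\bot$, $\mathbf{C}(\lrcorner\top)=\lrcorner\top$, $\mathbf{I}(x\sqcap x)=\mathbf{I}(x)$, $\mathbf{C}(x\sqcup x)=\mathbf{C}(x)$. A topological pdBa (tpdBa) is a pdBao which moreover satisfies $\mathbf{I}(x)\sqsubseteq x$, $x\sqsubseteq\mathbf{C}(x)$, $\mathbf{I}\mathbf{I}(x)=\mathbf{I}(x)$, $\mathbf{C}\mathbf{C}(x)=\mathbf{C}(x)$ for all $x$. The logic PDBL. Variables: object variables $\mathbf{OV}$ ($p,\dots$) and property variables $\mathbf{PV}$ ($P,\dots$), disjoint countably infinite sets; constants $\top,\bot$; connectives $\sqcap,\sqcup$ (binary), $\neg,\lrcorner$ (unary). $\alpha\vee\beta:=\neg(\neg\alpha\sqcap\neg\beta)$,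 $\alpha\wedge\beta:=\lrcorner(\lrcorner\alpha\sqcup\lrcorner\beta)$. Sequents $\alpha\vdash\beta$ ($\alpha\dashv\vdash\beta$ means both directions); s-hypersequents are finite sequences $\alpha_1\vdash\beta_1\mid\dots\mid\alpha_n\vdash\beta_n$; $B,C,\dots,X$ range over possibly empty s-hypersequents. Axioms: $\alpha\vdash\alpha$; $\alpha\sqcap\beta\vdash\alpha$; $\alpha\sqcap\beta\vdash\beta$; $\alpha\vdash\alpha\sqcup\beta$; $\beta\vdash\alpha\sqcup\beta$; $\alpha\sqcap\beta\vdash(\alpha\sqcap\beta)\sqcap(\alpha\sqcap\beta)$; $(\alpha\sqcup\beta)\sqcup(\alpha\sqcup\beta)\vdash\alpha\sqcup\beta$; $\neg(\alpha\sqcap\alpha)\vdash\neg\alpha$; $\lrcorner\alpha\vdash\lrcorner(\alpha\sqcup\alpha)$; $\alpha\sqcap\neg\alpha\vdash\bot$; $\top\vdash\alpha\sqcup\lrcorner\alpha$; $\neg\neg(\alpha\sqcap\beta)\dashv\vdash\alpha\sqcap\beta$; $\lrcorner\lrcorner(\alpha\sqcup\beta)\dashv\vdash\alpha\sqcup\beta$; $\alpha\sqcap\alpha\vdash\alpha\sqcap(\alpha\sqcup\beta)$; $\alpha\sqcup(\alpha\sqcap\beta)\vdash\alpha\sqcup\alpha$; $\alpha\sqcap\alpha\vdash\alpha\sqcap(\alpha\vee\beta)$; $\alpha\sqcup(\alpha\wedge\beta)\vdash\alpha\sqcup\alpha$; $\alpha\sqcap(\beta\vee\gamma)\dashv\vdash(\alpha\sqcap\beta)\vee(\alpha\sqcap\gamma)$;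 $\alpha\sqcup(\beta\wedge\gamma)\dashv\vdash(\alpha\sqcup\beta)\wedge(\alpha\sqcup\gamma)$; $\bot\vdash\alpha$; $\alpha\vdash\top$; $\neg\top\vdash\bot$; $\top\vdash\lrcorner\bot$; $\neg\bot\dashv\vdash\top\sqcap\top$; $\lrcorner\top\dashv\vdash\bot\sqcup\bot$; $(\alpha\sqcup\alpha)\sqcap(\alpha\sqcup\alpha)\dashv\vdash(\alpha\sqcap\alpha)\sqcup(\alpha\sqcap\alpha)$; $p\sqcap p\dashv\vdash p$ ($p\in\mathbf{OV}$); $P\sqcup P\dashv\vdash P$ ($P\in\mathbf{PV}$); (Sp) $\alpha\vdash\alpha\sqcap\alpha\mid\alpha\sqcup\alpha\vdash\alpha$. Rules: from $B\mid\alpha\vdash\beta\mid C$ infer $B\mid\alpha\sqcap\gamma\vdash\beta\sqcap\gamma\mid C$, $B\mid\gamma\sqcap\alpha\vdash\gamma\sqcap\beta\mid C$, $B\mid\alpha\sqcup\gamma\vdash\beta\sqcup\gamma\mid C$, $B\mid\gamma\sqcup\alpha\vdash\gamma\sqcup\beta\mid C$, $B\mid\neg\beta\vdash\neg\alpha\mid C$, $B\mid\lrcorner\beta\vdash\lrcorner\alpha\mid C$; from $B\mid\alpha\vdash\beta\mid C$ and $D\mid\beta\vdash\gamma\mid E$ infer $B\mid D\mid\alpha\vdash\gamma\mid C\mid E$; from $B\mid\alpha\sqcap\beta\vdash\alpha\sqcap\alpha\mid C$, $D\mid\alpha\sqcap\alpha\vdash\alpha\sqcap\beta\mid E$, $F\mid\alpha\sqcup\beta\vdash\beta\sqcup\beta\mid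 G$, $H\mid\beta\sqcup\beta\vdash\alpha\sqcup\beta\mid X$ infer $B\mid D\mid F\mid H\mid\alpha\vdash\beta\mid C\mid E\mid G\mid X$; external: from $B\mid D\mid D\mid C$ infer $B\mid D\mid C$; from $B\mid D\mid E\mid C$ infer $B\mid E\mid D\mid C$; from $B$ infer $B\mid C$. MPDBL and MPDBL4. $\mathbf{MPDBL}$ adds unary connectives $\square,\blacksquare$ (all PDBL axiom schemes and rules range over the enlarged set of formulae), with additional axioms $\square\alpha\sqcap\square\beta\dashv\vdash\square(\alpha\sqcap\beta)$; $\blacksquare\alpha\sqcup\blacksquare\beta\dashv\vdash\blacksquare(\alpha\sqcup\beta)$; $\square(\neg\bot)\dashv\vdash\neg\bot$; $\blacksquare(\lrcorner\top)\dashv\vdash\lrcorner\top$; $\square(\alpha\sqcap\alpha)\dashv\vdash\square\alpha$; $\blacksquare(\alpha\sqcup\alpha)\dashv\vdash\blacksquare\alpha$, and rules: from $B\mid\alpha\vdash\beta\mid C$ infer $B\mid\square\alpha\vdash\square\beta\mid C$ and $B\mid\blacksquare\alpha\vdash\blacksquare\beta\mid C$. $\mathbf{MPDBL4}$ is $\mathbf{MPDBL}$ plus the axioms $\square\alpha\vdash\alpha$, $\alpha\vdash\blacksquare\alpha$, $\square\square\alpha\dashv\vdash\square\alpha$, $\blacksquare\blacksquare\alpha\dashv\vdash\blacksquare\alpha$. Provability is via finite derivations. Semantics. A valuation on a pdBao is a map $v$ with $v(p)\in D_\sqcap$, $v(P)\in D_\sqcup$, $v(\top)=\top$, $v(\bot)=\bot$,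 extended homomorphically, with $v(\square\alpha)=\mathbf{I}(v(\alpha))$, $v(\blacksquare\alpha)=\mathbf{C}(v(\alpha))$. $v$ satisfies $\alpha\vdash\beta$ iff $v(\alpha)\sqsubseteq v(\beta)$, and an s-hypersequent iff it satisfies some component; an s-hypersequent is true in an algebra if every valuation satisfies it and valid in a class if true in each member. -}

module Defs where

open import Data.Nat using (ℕ)
open import Data.List using (List; []; _∷_; _++_; [_])
open import Data.List.Relation.Unary.Any using (Any)
open import Data.Product using (_×_; _,_; Σ)
open import Data.Sum using (_⊎_)
open import Relation.Binary.Structures using (IsEquivalence)
open import Function.Bundles using (_⇔_)

infixr 6 _⊓ᶠ_
infixr 5 _⊔ᶠ_
infix 4 _⊢_

data Fm : Set where
  ov    : ℕ → Fm
  pv    : ℕ → Fm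
  ⊤ᶠ ⊥ᶠ : Fm
  _⊓ᶠ_ _⊔ᶠ_ : Fm → Fm → Fm
  ¬ᶠ ⌟ᶠ : Fm → Fm
  □ ■   : Fm → Fm

_∨ᶠ_ : Fm → Fm → Fm
α ∨ᶠ β = ¬ᶠ (¬ᶠ α ⊓ᶠ ¬ᶠ β)

_∧ᶠ_ : Fm → Fm → Fm
α ∧ᶠ β = ⌟ᶠ (⌟ᶠ α ⊔ᶠ ⌟ᶠ β)

record Seq : Set where
  constructor _⊢_
  field
    lhs rhs : Fm

HS : Set
HS = List Seq

data Logic : Set where
  MPDBL MPDBL4 : Logic

-- single-sequent axioms (α ⊢ β); the ⊣⊢ axioms give both directions
data Axiom : Logic → Fm → Fm → Set where
  refl-ax : ∀ {L α} → Axiom L α α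
  ⊓-l : ∀ {L α β} → Axiom L (α ⊓ᶠ β) α
  ⊓-r : ∀ {L α β} → Axiom L (α ⊓ᶠ β) β
  ⊔-l : ∀ {L α β} → Axiom L α (α ⊔ᶠ β)
  ⊔-r : ∀ {L α β} → Axiom L β (α ⊔ᶠ β)
  ⊓-dup : ∀ {L α β} → Axiom L (α ⊓ᶠ β) ((α ⊓ᶠ β) ⊓ᶠ (α ⊓ᶠ β))
  ⊔-dup : ∀ {L α β} → Axiom L ((α ⊔ᶠ β) ⊔ᶠ (α ⊔ᶠ β)) (α ⊔ᶠ β)
  ¬-dup : ∀ {L α} → Axiom L (¬ᶠ (α ⊓ᶠ α)) (¬ᶠ α)
  ⌟-dup : ∀ {L α} → Axiom L (⌟ᶠ α) (⌟ᶠ (α ⊔ᶠ α))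
  ⊓¬ : ∀ {L α} → Axiom L (α ⊓ᶠ ¬ᶠ α) ⊥ᶠ
  ⊔⌟ : ∀ {L α} → Axiom L ⊤ᶠ (α ⊔ᶠ ⌟ᶠ α)
  ¬¬₁ : ∀ {L α β} → Axiom L (¬ᶠ (¬ᶠ (α ⊓ᶠ β))) (α ⊓ᶠ β)
  ¬¬₂ : ∀ {L α β} → Axiom L (α ⊓ᶠ β) (¬ᶠ (¬ᶠ (α ⊓ᶠ β)))
  ⌟⌟₁ : ∀ {L α β} → Axiom L (⌟ᶠ (⌟ᶠ (α ⊔ᶠ β))) (α ⊔ᶠ β)
  ⌟⌟₂ : ∀ {L α β} → Axiom L (α ⊔ᶠ β) (⌟ᶠ (⌟ᶠ (α ⊔ᶠ β)))
  abs₁ : ∀ {L α β} → Axiom L (α ⊓ᶠ α) (α ⊓ᶠ (α ⊔ᶠ β))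
  abs₂ : ∀ {L α β} → Axiom L (α ⊔ᶠ (α ⊓ᶠ β)) (α ⊔ᶠ α)
  abs₃ : ∀ {L α β} → Axiom L (α ⊓ᶠ α) (α ⊓ᶠ (α ∨ᶠ β))
  abs₄ : ∀ {L α β} → Axiom L (α ⊔ᶠ (α ∧ᶠ β)) (α ⊔ᶠ α)
  dist₁ : ∀ {L α β γ} → Axiom L (α ⊓ᶠ (β ∨ᶠ γ)) ((α ⊓ᶠ β) ∨ᶠ (α ⊓ᶠ γ))
  dist₂ : ∀ {L α β γ} → Axiom L ((α ⊓ᶠ β) ∨ᶠ (α ⊓ᶠ γ)) (α ⊓ᶠ (β ∨ᶠ γ))
  dist₃ : ∀ {L α β γ} → Axiom L (α ⊔ᶠ (β ∧ᶠ γ)) ((α ⊔ᶠ β) ∧ᶠ (α ⊔ᶠ γ))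
  dist₄ : ∀ {L α β γ} → Axiom L ((α ⊔ᶠ β) ∧ᶠ (α ⊔ᶠ γ)) (α ⊔ᶠ (β ∧ᶠ γ))
  ⊥-ax : ∀ {L α} → Axiom L ⊥ᶠ α
  ⊤-ax : ∀ {L α} → Axiom L α ⊤ᶠ
  ax-¬⊤ : ∀ {L} → Axiom L (¬ᶠ ⊤ᶠ) ⊥ᶠ
  ax-⌟⊥ : ∀ {L} → Axiom L ⊤ᶠ (⌟ᶠ ⊥ᶠ)
  ¬⊥₁ : ∀ {L} → Axiom L (¬ᶠ ⊥ᶠ) (⊤ᶠ ⊓ᶠ ⊤ᶠ)
  ¬⊥₂ : ∀ {L} → Axiom L (⊤ᶠ ⊓ᶠ ⊤ᶠ) (¬ᶠ ⊥ᶠ)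
  ⌟⊤₁ : ∀ {L} → Axiom L (⌟ᶠ ⊤ᶠ) (⊥ᶠ ⊔ᶠ ⊥ᶠ)
  ⌟⊤₂ : ∀ {L} → Axiom L (⊥ᶠ ⊔ᶠ ⊥ᶠ) (⌟ᶠ ⊤ᶠ)
  mix₁ : ∀ {L α} → Axiom L ((α ⊔ᶠ α) ⊓ᶠ (α ⊔ᶠ α)) ((α ⊓ᶠ α) ⊔ᶠ (α ⊓ᶠ α))
  mix₂ : ∀ {L α} → Axiom L ((α ⊓ᶠ α) ⊔ᶠ (α ⊓ᶠ α)) ((α ⊔ᶠ α) ⊓ᶠ (α ⊔ᶠ α))
  ov₁ : ∀ {L n} → Axiom L (ov n ⊓ᶠ ov n) (ov n)
  ov₂ : ∀ {L n} → Axiom L (ov n) (ov n ⊓ᶠ ov n)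
  pv₁ : ∀ {L n} → Axiom L (pv n ⊔ᶠ pv n) (pv n)
  pv₂ : ∀ {L n} → Axiom L (pv n) (pv n ⊔ᶠ pv n)
  □⊓₁ : ∀ {L α β} → Axiom L (□ α ⊓ᶠ □ β) (□ (α ⊓ᶠ β))
  □⊓₂ : ∀ {L α β} → Axiom L (□ (α ⊓ᶠ β)) (□ α ⊓ᶠ □ β)
  ■⊔₁ : ∀ {L α β} → Axiom L (■ α ⊔ᶠ ■ β) (■ (α ⊔ᶠ β))
  ■⊔₂ : ∀ {L α β} → Axiom L (■ (α ⊔ᶠ β)) (■ α ⊔ᶠ ■ β)
  □¬⊥₁ : ∀ {L} → Axiom L (□ (¬ᶠ ⊥ᶠ)) (¬ᶠ ⊥ᶠ)
  □¬⊥₂ : ∀ {L} → Axiom L (¬ᶠ ⊥ᶠ) (□ (¬ᶠ ⊥ᶠ))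
  ■⌟⊤₁ : ∀ {L} → Axiom L (■ (⌟ᶠ ⊤ᶠ)) (⌟ᶠ ⊤ᶠ)
  ■⌟⊤₂ : ∀ {L} → Axiom L (⌟ᶠ ⊤ᶠ) (■ (⌟ᶠ ⊤ᶠ))
  □dup₁ : ∀ {L α} → Axiom L (□ (α ⊓ᶠ α)) (□ α)
  □dup₂ : ∀ {L α} → Axiom L (□ α) (□ (α ⊓ᶠ α))
  ■dup₁ : ∀ {L α} → Axiom L (■ (α ⊔ᶠ α)) (■ α)
  ■dup₂ : ∀ {L α} → Axiom L (■ α) (■ (α ⊔ᶠ α))
  □T : ∀ {α} → Axiom MPDBL4 (□ α) α
  ■T : ∀ {α} → Axiom MPDBL4 α (■ α)
  □4₁ : ∀ {α} → Axiom MPDBL4 (□ (□ α)) (□ α)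
  □4₂ : ∀ {α} → Axiom MPDBL4 (□ α) (□ (□ α))
  ■4₁ : ∀ {α} → Axiom MPDBL4 (■ (■ α)) (■ α)
  ■4₂ : ∀ {α} → Axiom MPDBL4 (■ α) (■ (■ α))

-- derivability of s-hypersequents; "B ++ s ∷ C" is  B | s | C
data Prov (L : Logic) : HS → Set where
  ax : ∀ {α β} → Axiom L α β → Prov L [ α ⊢ β ]
  sp : ∀ {α} → Prov L ((α ⊢ α ⊓ᶠ α) ∷ (α ⊔ᶠ α ⊢ α) ∷ [])
  ⊓R : ∀ {B C α β γ} → Prov L (B ++ (α ⊢ β) ∷ C) → Prov L (B ++ (α ⊓ᶠ γ ⊢ β ⊓ᶠ γ) ∷ C)
  ⊓L : ∀ {B C α β γ} → Prov L (B ++ (α ⊢ β) ∷ C) → Prov L (B ++ (γ ⊓ᶠ α ⊢ γ ⊓ᶠ β) ∷ C)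
  ⊔R : ∀ {B C α β γ} → Prov L (B ++ (α ⊢ β) ∷ C) → Prov L (B ++ (α ⊔ᶠ γ ⊢ β ⊔ᶠ γ) ∷ C)
  ⊔L : ∀ {B C α β γ} → Prov L (B ++ (α ⊢ β) ∷ C) → Prov L (B ++ (γ ⊔ᶠ α ⊢ γ ⊔ᶠ β) ∷ C)
  ¬R : ∀ {B C α β} → Prov L (B ++ (α ⊢ β) ∷ C) → Prov L (B ++ (¬ᶠ β ⊢ ¬ᶠ α) ∷ C)
  ⌟R : ∀ {B C α β} → Prov L (B ++ (α ⊢ β) ∷ C) → Prov L (B ++ (⌟ᶠ β ⊢ ⌟ᶠ α) ∷ C)
  □R : ∀ {B C α β} → Prov L (B ++ (α ⊢ β) ∷ C) → Prov L (B ++ (□ α ⊢ □ β) ∷ C)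
  ■R : ∀ {B C α β} → Prov L (B ++ (α ⊢ β) ∷ C) → Prov L (B ++ (■ α ⊢ ■ β) ∷ C)
  cut : ∀ {B C D E α β γ} →
        Prov L (B ++ (α ⊢ β) ∷ C) → Prov L (D ++ (β ⊢ γ) ∷ E) →
        Prov L (B ++ D ++ (α ⊢ γ) ∷ C ++ E)
  antisym : ∀ {B C D E F G H X α β} →
        Prov L (B ++ (α ⊓ᶠ β ⊢ α ⊓ᶠ α) ∷ C) →
        Prov L (D ++ (α ⊓ᶠ α ⊢ α ⊓ᶠ β) ∷ E) →
        Prov L (F ++ (α ⊔ᶠ β ⊢ β ⊔ᶠ β) ∷ G) →
        Prov L (H ++ (β ⊔ᶠ β ⊢ α ⊔ᶠ β) ∷ X) →
        Prov L (B ++ D ++ F ++ H ++ (α ⊢ β) ∷ C ++ E ++ G ++ X)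
  ec : ∀ {B C D} → Prov L (B ++ D ++ D ++ C) → Prov L (B ++ D ++ C)
  ee : ∀ {B C D E} → Prov L (B ++ D ++ E ++ C) → Prov L (B ++ E ++ D ++ C)
  ew : ∀ {B C} → Prov L B → Prov L (B ++ C)

record PDBAO : Set₁ where
  infixr 6 _⊓_
  infixr 5 _⊔_
  infix 4 _≈_ _⊑_
  field
    Carrier : Set
    _≈_ : Carrier → Carrier → Set
    isEquivalence : IsEquivalence _≈_
    _⊓_ _⊔_ : Carrier → Carrier → Carrier
    ¬_ ⌟_ : Carrier → Carrier
    ⊤ ⊥ : Carrier
    𝐈 𝐂 : Carrier → Carrier
    ⊓-cong : ∀ {x x′ y y′} → x ≈ x′ → y ≈ y′ → x ⊓ y ≈ x′ ⊓ y′
    ⊔-cong : ∀ {x x′ y y′} → x ≈ x′ → y ≈ y′ → x ⊔ y ≈ x′ ⊔ y′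
    ¬-cong : ∀ {x x′} → x ≈ x′ → ¬ x ≈ ¬ x′
    ⌟-cong : ∀ {x x′} → x ≈ x′ → ⌟ x ≈ ⌟ x′
    𝐈-cong : ∀ {x x′} → x ≈ x′ → 𝐈 x ≈ 𝐈 x′
    𝐂-cong : ∀ {x x′} → x ≈ x′ → 𝐂 x ≈ 𝐂 x′

  _∨_ : Carrier → Carrier → Carrier
  x ∨ y = ¬ (¬ x ⊓ ¬ y)

  _∧_ : Carrier → Carrier → Carrier
  x ∧ y = ⌟ (⌟ x ⊔ ⌟ y)

  _⊑_ : Carrier → Carrier → Set
  x ⊑ y = (x ⊓ y ≈ x ⊓ x) × (x ⊔ y ≈ y ⊔ y)

  field
    ⊓-idem-l : ∀ x y → (x ⊓ x) ⊓ y ≈ x ⊓ y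
    ⊔-idem-l : ∀ x y → (x ⊔ x) ⊔ y ≈ x ⊔ y
    ⊓-comm : ∀ x y → x ⊓ y ≈ y ⊓ x
    ⊔-comm : ∀ x y → x ⊔ y ≈ y ⊔ x
    ⊓-assoc : ∀ x y z → (x ⊓ y) ⊓ z ≈ x ⊓ (y ⊓ z)
    ⊔-assoc : ∀ x y z → (x ⊔ y) ⊔ z ≈ x ⊔ (y ⊔ z)
    ¬-idem : ∀ x → ¬ (x ⊓ x) ≈ ¬ x
    ⌟-idem : ∀ x → ⌟ (x ⊔ x) ≈ ⌟ x
    abs-⊓⊔ : ∀ x y → x ⊓ (x ⊔ y) ≈ x ⊓ x
    abs-⊔⊓ : ∀ x y → x ⊔ (x ⊓ y) ≈ x ⊔ x
    dist-⊓∨ : ∀ x y z → x ⊓ (y ∨ z) ≈ (x ⊓ y) ∨ (x ⊓ z)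
    dist-⊔∧ : ∀ x y z → x ⊔ (y ∧ z) ≈ (x ⊔ y) ∧ (x ⊔ z)
    abs-⊓∨ : ∀ x y → x ⊓ (x ∨ y) ≈ x ⊓ x
    abs-⊔∧ : ∀ x y → x ⊔ (x ∧ y) ≈ x ⊔ x
    ¬¬ : ∀ x y → ¬ (¬ (x ⊓ y)) ≈ x ⊓ y
    ⌟⌟ : ∀ x y → ⌟ (⌟ (x ⊔ y)) ≈ x ⊔ y
    ⊓-¬ : ∀ x → x ⊓ ¬ x ≈ ⊥
    ⊔-⌟ : ∀ x → x ⊔ ⌟ x ≈ ⊤
    ¬⊥ : ¬ ⊥ ≈ ⊤ ⊓ ⊤
    ⌟⊤ : ⌟ ⊤ ≈ ⊥ ⊔ ⊥
    ¬⊤ : ¬ ⊤ ≈ ⊥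
    ⌟⊥ : ⌟ ⊥ ≈ ⊤
    ⊓⊔-mix : ∀ x → (x ⊓ x) ⊔ (x ⊓ x) ≈ (x ⊔ x) ⊓ (x ⊔ x)
    pure : ∀ x → (x ⊓ x ≈ x) ⊎ (x ⊔ x ≈ x)
    𝐈-mono : ∀ {x y} → x ⊑ y → 𝐈 x ⊑ 𝐈 y
    𝐂-mono : ∀ {x y} → x ⊑ y → 𝐂 x ⊑ 𝐂 y
    𝐈-⊓ : ∀ x y → 𝐈 (x ⊓ y) ≈ 𝐈 x ⊓ 𝐈 y
    𝐂-⊔ : ∀ x y → 𝐂 (x ⊔ y) ≈ 𝐂 x ⊔ 𝐂 y
    𝐈-¬⊥ : 𝐈 (¬ ⊥) ≈ ¬ ⊥
    𝐂-⌟⊤ : 𝐂 (⌟ ⊤) ≈ ⌟ ⊤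
    𝐈-dup : ∀ x → 𝐈 (x ⊓ x) ≈ 𝐈 x
    𝐂-dup : ∀ x → 𝐂 (x ⊔ x) ≈ 𝐂 x

record Topological (A : PDBAO) : Set where
  open PDBAO A
  field
    𝐈-defl : ∀ x → 𝐈 x ⊑ x
    𝐂-infl : ∀ x → x ⊑ 𝐂 x
    𝐈𝐈 : ∀ x → 𝐈 (𝐈 x) ≈ 𝐈 x
    𝐂𝐂 : ∀ x → 𝐂 (𝐂 x) ≈ 𝐂 x

record Valuation (A : PDBAO) : Set where
  open PDBAO A
  field
    vo : ℕ → Carrier
    vp : ℕ → Carrier
    vo-⊓ : ∀ n → vo n ⊓ vo n ≈ vo n
    vp-⊔ : ∀ n → vp n ⊔ vp n ≈ vp n

module _ {A : PDBAO} (v : Valuation A) where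
  open PDBAO A
  open Valuation v

  ⟦_⟧ : Fm → Carrier
  ⟦ ov n ⟧ = vo n
  ⟦ pv n ⟧ = vp n
  ⟦ ⊤ᶠ ⟧ = ⊤
  ⟦ ⊥ᶠ ⟧ = ⊥
  ⟦ α ⊓ᶠ β ⟧ = ⟦ α ⟧ ⊓ ⟦ β ⟧
  ⟦ α ⊔ᶠ β ⟧ = ⟦ α ⟧ ⊔ ⟦ β ⟧
  ⟦ ¬ᶠ α ⟧ = ¬ ⟦ α ⟧
  ⟦ ⌟ᶠ α ⟧ = ⌟ ⟦ α ⟧
  ⟦ □ α ⟧ = 𝐈 ⟦ α ⟧
  ⟦ ■ α ⟧ = 𝐂 ⟦ α ⟧

  SatSeq : Seq → Set
  SatSeq (α ⊢ β) = ⟦ α ⟧ ⊑ ⟦ β ⟧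

  SatHS : HS → Set
  SatHS H = Any SatSeq H

TrueIn : PDBAO → HS → Set
TrueIn A H = (v : Valuation A) → SatHS v H

ValidPDBAO : HS → Set₁
ValidPDBAO H = (A : PDBAO) → TrueIn A H

ValidTPDBA : HS → Set₁
ValidTPDBA H = (A : PDBAO) → Topological A → TrueIn A H

{-# OPTIONS --safe #-}
-- Soundness reduces every axiom and rule to an order-theoretic fact about ⊑ in
-- a pdBao; only the ⊓-half of these facts is proved directly, the ⊔-half being
-- its image under the self-duality of pdBaos.  For completeness, formulae modulo
-- provable equivalence form a pdBao (pure because each formula is provably in
-- D⊓ or in D⊔ according to its main connective), topological for MPDBL4.  Under
-- the identity valuation a sequent holds there iff it is provable, so a valid
-- s-hypersequent has a provable component and hence is provable by weakening.
module Submission where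

open import Defs
open import Algebra.Bundles using (CommutativeSemigroup)
import Algebra.Properties.CommutativeSemigroup as CommutativeSemigroupProperties
open import Data.List using ([]; _∷_; _++_; [_])
open import Data.List.Properties using (++-identityʳ)
open import Data.List.Relation.Unary.Any as Any using (Any; here; there)
open import Data.List.Relation.Unary.Any.Properties using (++⁺ˡ; ++⁺ʳ; ++⁻; ++-insert)
open import Data.List.Relation.Binary.Permutation.Propositional using (↭-sym)
import Data.List.Relation.Binary.Permutation.Propositional.Properties as ↭
open import Data.Product using (_×_; _,_; swap)
open import Data.Sum using (_⊎_; inj₁; inj₂; [_,_]′)
import Data.Sum as Sum
open import Data.Unit using () renaming (⊤ to Unit; tt to unit)
open import Function using (_∘_; id)
open import Function.Bundles using (_⇔_; mk⇔)
open import Level using (0ℓ)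
open import Relation.Binary.Bundles using (Setoid)
open import Relation.Binary.Structures using (IsEquivalence)
import Relation.Binary.Reasoning.Setoid as SetoidReasoning
open import Relation.Binary.PropositionalEquality using (_≡_; cong; cong₂; subst; subst₂)
open import Relation.Unary using (Pred)

module HalfOrder (A : PDBAO) where
  open PDBAO A
  open IsEquivalence isEquivalence

  ≈-setoid : Setoid 0ℓ 0ℓ
  ≈-setoid = record { isEquivalence = isEquivalence }

  ⊓-commutativeSemigroup : CommutativeSemigroup 0ℓ 0ℓ
  ⊓-commutativeSemigroup = record
    { isCommutativeSemigroup = record
      { isSemigroup = record
        { isMagma = record { isEquivalence = isEquivalence ; ∙-cong = ⊓-cong }
        ; assoc = ⊓-assoc }
      ; comm = ⊓-comm } }

  open SetoidReasoning ≈-setoid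
  open CommutativeSemigroupProperties ⊓-commutativeSemigroup using (interchange)

  D⊓ : Carrier → Set
  D⊓ x = x ⊓ x ≈ x

  infix 4 _≤⊓_
  _≤⊓_ : Carrier → Carrier → Set
  x ≤⊓ y = x ⊓ y ≈ x ⊓ x

  ⊓-idemʳ : ∀ x y → x ⊓ (y ⊓ y) ≈ x ⊓ y
  ⊓-idemʳ x y = begin
    x ⊓ (y ⊓ y)  ≈⟨ ⊓-comm x (y ⊓ y) ⟩
    (y ⊓ y) ⊓ x  ≈⟨ ⊓-idem-l y x ⟩
    y ⊓ x        ≈⟨ ⊓-comm y x ⟩
    x ⊓ y        ∎

  ⊓∈D⊓ : ∀ x y → D⊓ (x ⊓ y)
  ⊓∈D⊓ x y = begin
    (x ⊓ y) ⊓ (x ⊓ y)  ≈⟨ interchange x y x y ⟩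
    (x ⊓ x) ⊓ (y ⊓ y)  ≈⟨ ⊓-idem-l x (y ⊓ y) ⟩
    x ⊓ (y ⊓ y)        ≈⟨ ⊓-idemʳ x y ⟩
    x ⊓ y              ∎

  ¬¬≈⊓ : ∀ x → ¬ (¬ x) ≈ x ⊓ x
  ¬¬≈⊓ x = begin
    ¬ (¬ x)        ≈⟨ ¬-cong (¬-idem x) ⟨
    ¬ (¬ (x ⊓ x))  ≈⟨ ¬¬ x x ⟩
    x ⊓ x          ∎

  ¬∈D⊓ : ∀ x → D⊓ (¬ x)
  ¬∈D⊓ x = begin
    ¬ x ⊓ ¬ x      ≈⟨ ¬¬≈⊓ (¬ x) ⟨
    ¬ (¬ (¬ x))    ≈⟨ ¬-cong (¬¬≈⊓ x) ⟩
    ¬ (x ⊓ x)      ≈⟨ ¬-idem x ⟩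
    ¬ x            ∎

  ¬∨¬ : ∀ x y → (¬ x) ∨ (¬ y) ≈ ¬ (x ⊓ y)
  ¬∨¬ x y = begin
    ¬ (¬ (¬ x) ⊓ ¬ (¬ y))  ≈⟨ ¬-cong (⊓-cong (¬¬≈⊓ x) (¬¬≈⊓ y)) ⟩
    ¬ ((x ⊓ x) ⊓ (y ⊓ y))  ≈⟨ ¬-cong (⊓-idem-l x (y ⊓ y)) ⟩
    ¬ (x ⊓ (y ⊓ y))        ≈⟨ ¬-cong (⊓-idemʳ x y) ⟩
    ¬ (x ⊓ y)              ∎

  ⊓-zeroʳ : ∀ x → x ⊓ ⊥ ≈ ⊥
  ⊓-zeroʳ x = begin
    x ⊓ ⊥            ≈⟨ ⊓-cong refl (⊓-¬ x) ⟨
    x ⊓ (x ⊓ ¬ x)    ≈⟨ ⊓-assoc x x (¬ x) ⟨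
    (x ⊓ x) ⊓ ¬ x    ≈⟨ ⊓-idem-l x (¬ x) ⟩
    x ⊓ ¬ x          ≈⟨ ⊓-¬ x ⟩
    ⊥                ∎

  ≤⊓-trans : ∀ {x y z} → x ≤⊓ y → y ≤⊓ z → x ≤⊓ z
  ≤⊓-trans {x} {y} {z} x≤y y≤z = begin
    x ⊓ z        ≈⟨ ⊓-idem-l x z ⟨
    (x ⊓ x) ⊓ z  ≈⟨ ⊓-cong x≤y refl ⟨
    (x ⊓ y) ⊓ z  ≈⟨ ⊓-assoc x y z ⟩
    x ⊓ (y ⊓ z)  ≈⟨ ⊓-cong refl y≤z ⟩
    x ⊓ (y ⊓ y)  ≈⟨ ⊓-idemʳ x y ⟩
    x ⊓ y        ≈⟨ x≤y ⟩
    x ⊓ x        ∎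

  ≤⊓-antisym : ∀ {x y} → x ≤⊓ y → y ≤⊓ x → x ⊓ x ≈ y ⊓ y
  ≤⊓-antisym {x} {y} x≤y y≤x = trans (sym x≤y) (trans (⊓-comm x y) y≤x)

  ⊓-mono-≤⊓ : ∀ {a b c d} → a ≤⊓ b → c ≤⊓ d → a ⊓ c ≤⊓ b ⊓ d
  ⊓-mono-≤⊓ {a} {b} {c} {d} a≤b c≤d = begin
    (a ⊓ c) ⊓ (b ⊓ d)  ≈⟨ interchange a c b d ⟩
    (a ⊓ b) ⊓ (c ⊓ d)  ≈⟨ ⊓-cong a≤b c≤d ⟩
    (a ⊓ a) ⊓ (c ⊓ c)  ≈⟨ interchange a c a c ⟨
    (a ⊓ c) ⊓ (a ⊓ c)  ∎

  D⊓-≤⊓⇒⊑ : ∀ {x y} → D⊓ x → x ≤⊓ y → x ⊑ y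
  D⊓-≤⊓⇒⊑ {x} {y} x∈D⊓ x≤y = x≤y , (begin
    x ⊔ y        ≈⟨ ⊔-cong (trans (sym x∈D⊓) (sym x≤y)) refl ⟩
    (x ⊓ y) ⊔ y  ≈⟨ ⊔-comm (x ⊓ y) y ⟩
    y ⊔ (x ⊓ y)  ≈⟨ ⊔-cong refl (⊓-comm x y) ⟩
    y ⊔ (y ⊓ x)  ≈⟨ abs-⊔⊓ y x ⟩
    y ⊔ y        ∎)

  ⊓-lowerˡ : ∀ x y → x ⊓ y ⊑ x
  ⊓-lowerˡ x y = D⊓-≤⊓⇒⊑ (⊓∈D⊓ x y) (begin
    (x ⊓ y) ⊓ x        ≈⟨ ⊓-comm (x ⊓ y) x ⟩
    x ⊓ (x ⊓ y)        ≈⟨ ⊓-assoc x x y ⟨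
    (x ⊓ x) ⊓ y        ≈⟨ ⊓-idem-l x y ⟩
    x ⊓ y              ≈⟨ ⊓∈D⊓ x y ⟨
    (x ⊓ y) ⊓ (x ⊓ y)  ∎)

  ⊓-lowerʳ : ∀ x y → x ⊓ y ⊑ y
  ⊓-lowerʳ x y = D⊓-≤⊓⇒⊑ (⊓∈D⊓ x y) (begin
    (x ⊓ y) ⊓ y        ≈⟨ ⊓-assoc x y y ⟩
    x ⊓ (y ⊓ y)        ≈⟨ ⊓-idemʳ x y ⟩
    x ⊓ y              ≈⟨ ⊓∈D⊓ x y ⟨
    (x ⊓ y) ⊓ (x ⊓ y)  ∎)

  ⊓-mono : ∀ {a b c d} → a ⊑ b → c ⊑ d → a ⊓ c ⊑ b ⊓ d
  ⊓-mono {a} {c = c} (a≤b , _) (c≤d , _) = D⊓-≤⊓⇒⊑ (⊓∈D⊓ a c) (⊓-mono-≤⊓ a≤b c≤d)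

  ¬-antitone : ∀ {a b} → a ⊑ b → ¬ b ⊑ ¬ a
  ¬-antitone {a} {b} (a≤b , _) = D⊓-≤⊓⇒⊑ (¬∈D⊓ b) (begin
    ¬ b ⊓ ¬ a              ≈⟨ ⊓-cong refl ¬a≈¬b∨¬a ⟩
    ¬ b ⊓ ((¬ b) ∨ (¬ a))  ≈⟨ abs-⊓∨ (¬ b) (¬ a) ⟩
    ¬ b ⊓ ¬ b              ∎)
    where
    ¬a≈¬b∨¬a : ¬ a ≈ (¬ b) ∨ (¬ a)
    ¬a≈¬b∨¬a = begin
      ¬ a            ≈⟨ ¬-idem a ⟨
      ¬ (a ⊓ a)      ≈⟨ ¬-cong a≤b ⟨
      ¬ (a ⊓ b)      ≈⟨ ¬-cong (⊓-comm a b) ⟩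
      ¬ (b ⊓ a)      ≈⟨ ¬∨¬ b a ⟨
      (¬ b) ∨ (¬ a)  ∎

  ⊥-least : ∀ x → ⊥ ⊑ x
  ⊥-least x = D⊓-≤⊓⇒⊑ (⊓-zeroʳ ⊥) (begin
    ⊥ ⊓ x  ≈⟨ ⊓-comm ⊥ x ⟩
    x ⊓ ⊥  ≈⟨ ⊓-zeroʳ x ⟩
    ⊥      ≈⟨ ⊓-zeroʳ ⊥ ⟨
    ⊥ ⊓ ⊥  ∎)

-- The order dual: swap ⊓/⊔, ¬/⌟, ⊤/⊥ and 𝐈/𝐂, and flip the arguments of the
-- binary operations so that x ⊑ y in the dual is literally (y ⊑ x) with its
-- two components swapped.
dual : PDBAO → PDBAO
dual A = record
  { Carrier = Carrier
  ; _≈_ = _≈_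
  ; isEquivalence = isEquivalence
  ; _⊓_ = λ x y → y ⊔ x
  ; _⊔_ = λ x y → y ⊓ x
  ; ¬_ = ⌟_
  ; ⌟_ = ¬_
  ; ⊤ = ⊥
  ; ⊥ = ⊤
  ; 𝐈 = 𝐂
  ; 𝐂 = 𝐈
  ; ⊓-cong = λ x≈x′ y≈y′ → ⊔-cong y≈y′ x≈x′
  ; ⊔-cong = λ x≈x′ y≈y′ → ⊓-cong y≈y′ x≈x′
  ; ¬-cong = ⌟-cong
  ; ⌟-cong = ¬-cong
  ; 𝐈-cong = 𝐂-cong
  ; 𝐂-cong = 𝐈-cong
  ; ⊓-idem-l = λ x y → trans (⊔-comm y (x ⊔ x)) (trans (⊔-idem-l x y) (⊔-comm x y))
  ; ⊔-idem-l = λ x y → trans (⊓-comm y (x ⊓ x)) (trans (⊓-idem-l x y) (⊓-comm x y))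
  ; ⊓-comm = λ x y → ⊔-comm y x
  ; ⊔-comm = λ x y → ⊓-comm y x
  ; ⊓-assoc = λ x y z → sym (⊔-assoc z y x)
  ; ⊔-assoc = λ x y z → sym (⊓-assoc z y x)
  ; ¬-idem = ⌟-idem
  ; ⌟-idem = ¬-idem
  ; abs-⊓⊔ = λ x y → trans (⊔-comm (y ⊓ x) x) (trans (⊔-cong refl (⊓-comm y x)) (abs-⊔⊓ x y))
  ; abs-⊔⊓ = λ x y → trans (⊓-comm (y ⊔ x) x) (trans (⊓-cong refl (⊔-comm y x)) (abs-⊓⊔ x y))
  ; dist-⊓∨ = λ x y z →
      trans (⊔-comm (z ∧ y) x) (trans (dist-⊔∧ x z y) (∧-cong (⊔-comm x z) (⊔-comm x y)))
  ; dist-⊔∧ = λ x y z →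
      trans (⊓-comm (z ∨ y) x) (trans (dist-⊓∨ x z y) (∨-cong (⊓-comm x z) (⊓-comm x y)))
  ; abs-⊓∨ = λ x y →
      trans (⊔-comm (y ∧ x) x) (trans (⊔-cong refl (⌟-cong (⊔-comm (⌟ y) (⌟ x)))) (abs-⊔∧ x y))
  ; abs-⊔∧ = λ x y →
      trans (⊓-comm (y ∨ x) x) (trans (⊓-cong refl (¬-cong (⊓-comm (¬ y) (¬ x)))) (abs-⊓∨ x y))
  ; ¬¬ = λ x y → ⌟⌟ y x
  ; ⌟⌟ = λ x y → ¬¬ y x
  ; ⊓-¬ = λ x → trans (⊔-comm (⌟ x) x) (⊔-⌟ x)
  ; ⊔-⌟ = λ x → trans (⊓-comm (¬ x) x) (⊓-¬ x)
  ; ¬⊥ = ⌟⊤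
  ; ⌟⊤ = ¬⊥
  ; ¬⊤ = ⌟⊥
  ; ⌟⊥ = ¬⊤
  ; ⊓⊔-mix = λ x → sym (⊓⊔-mix x)
  ; pure = Sum.swap ∘ pure
  ; 𝐈-mono = λ x⊑y → swap (𝐂-mono (swap x⊑y))
  ; 𝐂-mono = λ x⊑y → swap (𝐈-mono (swap x⊑y))
  ; 𝐈-⊓ = λ x y → 𝐂-⊔ y x
  ; 𝐂-⊔ = λ x y → 𝐈-⊓ y x
  ; 𝐈-¬⊥ = 𝐂-⌟⊤
  ; 𝐂-⌟⊤ = 𝐈-¬⊥
  ; 𝐈-dup = 𝐂-dup
  ; 𝐂-dup = 𝐈-dup
  }
  where
  open PDBAO A
  open IsEquivalence isEquivalence

  ∧-cong : ∀ {x x′ y y′} → x ≈ x′ → y ≈ y′ → x ∧ y ≈ x′ ∧ y′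
  ∧-cong x≈x′ y≈y′ = ⌟-cong (⊔-cong (⌟-cong x≈x′) (⌟-cong y≈y′))

  ∨-cong : ∀ {x x′ y y′} → x ≈ x′ → y ≈ y′ → x ∨ y ≈ x′ ∨ y′
  ∨-cong x≈x′ y≈y′ = ¬-cong (⊓-cong (¬-cong x≈x′) (¬-cong y≈y′))

module Order (A : PDBAO) where
  open PDBAO A
  open IsEquivalence isEquivalence
  open HalfOrder A public
  private module Dual = HalfOrder (dual A)

  ⊔∈D⊔ : ∀ x y → (x ⊔ y) ⊔ (x ⊔ y) ≈ x ⊔ y
  ⊔∈D⊔ x y = Dual.⊓∈D⊓ y x

  ≈⇒⊑ : ∀ {x y} → x ≈ y → x ⊑ y
  ≈⇒⊑ x≈y = ⊓-cong refl (sym x≈y) , ⊔-cong x≈y refl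

  ⊑-refl : ∀ {x} → x ⊑ x
  ⊑-refl = ≈⇒⊑ refl

  ⊑-trans : ∀ {x y z} → x ⊑ y → y ⊑ z → x ⊑ z
  ⊑-trans (x≤⊓y , x≤⊔y) (y≤⊓z , y≤⊔z) = ≤⊓-trans x≤⊓y y≤⊓z , Dual.≤⊓-trans y≤⊔z x≤⊔y

  ⊔-upperˡ : ∀ x y → x ⊑ x ⊔ y
  ⊔-upperˡ x y = swap (Dual.⊓-lowerʳ y x)

  ⊔-upperʳ : ∀ x y → y ⊑ x ⊔ y
  ⊔-upperʳ x y = swap (Dual.⊓-lowerˡ y x)

  ⊔-mono : ∀ {a b c d} → a ⊑ b → c ⊑ d → a ⊔ c ⊑ b ⊔ d
  ⊔-mono a⊑b c⊑d = swap (Dual.⊓-mono (swap c⊑d) (swap a⊑b))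

  ⌟-antitone : ∀ {a b} → a ⊑ b → ⌟ b ⊑ ⌟ a
  ⌟-antitone a⊑b = swap (Dual.¬-antitone (swap a⊑b))

  ⊤-greatest : ∀ x → x ⊑ ⊤
  ⊤-greatest x = swap (Dual.⊥-least x)

  ⊑-antisym-rule : ∀ {a b} → a ⊓ b ⊑ a ⊓ a → a ⊓ a ⊑ a ⊓ b →
                   a ⊔ b ⊑ b ⊔ b → b ⊔ b ⊑ a ⊔ b → a ⊑ b
  ⊑-antisym-rule {a} {b} (p₁ , _) (p₂ , _) (_ , p₃) (_ , p₄) =
    trans (sym (⊓∈D⊓ a b)) (trans (≤⊓-antisym p₁ p₂) (⊓∈D⊓ a a)) ,
    trans (sym (⊔∈D⊔ a b)) (trans (Dual.≤⊓-antisym p₄ p₃) (⊔∈D⊔ b b))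

module _ {a p} {X : Set a} {P : Pred X p} where

  Any-unshift : ∀ xs {x ys} → Any P (xs ++ x ∷ ys) → P x ⊎ Any P (xs ++ ys)
  Any-unshift xs {x} {ys} sat with ↭.Any-resp-↭ (↭.shift x xs ys) sat
  ... | here px = inj₁ px
  ... | there sat′ = inj₂ sat′

  Any-replace : ∀ xs {x y ys} → (P x → P y) → Any P (xs ++ x ∷ ys) → Any P (xs ++ y ∷ ys)
  Any-replace xs {y = y} {ys} f sat with Any-unshift xs sat
  ... | inj₁ px = ++-insert xs (f px)
  ... | inj₂ sat′ = ↭.Any-resp-↭ (↭-sym (↭.shift y xs ys)) (there sat′)

  Any-cut : ∀ xs ys {xs′ ys′ x y z} → (P x → P y → P z) →
            Any P (xs ++ x ∷ xs′) → Any P (ys ++ y ∷ ys′) →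
            Any P (xs ++ ys ++ z ∷ xs′ ++ ys′)
  Any-cut xs ys {xs′} f satˣ satʸ with Any-unshift xs satˣ | Any-unshift ys satʸ
  ... | inj₁ px | inj₁ py = ++⁺ʳ xs (++-insert ys (f px py))
  ... | inj₂ sat | _ = [ ++⁺ˡ , ++⁺ʳ xs ∘ ++⁺ʳ ys ∘ there ∘ ++⁺ˡ ]′ (++⁻ xs sat)
  ... | inj₁ _ | inj₂ sat = ++⁺ʳ xs ([ ++⁺ˡ , ++⁺ʳ ys ∘ there ∘ ++⁺ʳ xs′ ]′ (++⁻ ys sat))

  Any-cut₄ : ∀ ws xs ys zs {ws′ xs′ ys′ zs′ w x y z u} → (P w → P x → P y → P z → P u) →
             Any P (ws ++ w ∷ ws′) → Any P (xs ++ x ∷ xs′) →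
             Any P (ys ++ y ∷ ys′) → Any P (zs ++ z ∷ zs′) →
             Any P (ws ++ xs ++ ys ++ zs ++ u ∷ ws′ ++ xs′ ++ ys′ ++ zs′)
  Any-cut₄ ws xs ys zs {ws′} {xs′} {ys′} f satʷ satˣ satʸ satᶻ
    with Any-unshift ws satʷ | Any-unshift xs satˣ | Any-unshift ys satʸ | Any-unshift zs satᶻ
  ... | inj₁ pw | inj₁ px | inj₁ py | inj₁ pz =
    ++⁺ʳ ws (++⁺ʳ xs (++⁺ʳ ys (++-insert zs (f pw px py pz))))
  ... | inj₂ sat | _ | _ | _ =
    [ ++⁺ˡ , ++⁺ʳ ws ∘ ++⁺ʳ xs ∘ ++⁺ʳ ys ∘ ++⁺ʳ zs ∘ there ∘ ++⁺ˡ ]′ (++⁻ ws sat)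
  ... | inj₁ _ | inj₂ sat | _ | _ = ++⁺ʳ ws
    ([ ++⁺ˡ , ++⁺ʳ xs ∘ ++⁺ʳ ys ∘ ++⁺ʳ zs ∘ there ∘ ++⁺ʳ ws′ ∘ ++⁺ˡ ]′ (++⁻ xs sat))
  ... | inj₁ _ | inj₁ _ | inj₂ sat | _ = ++⁺ʳ ws (++⁺ʳ xs
    ([ ++⁺ˡ , ++⁺ʳ ys ∘ ++⁺ʳ zs ∘ there ∘ ++⁺ʳ ws′ ∘ ++⁺ʳ xs′ ∘ ++⁺ˡ ]′ (++⁻ ys sat)))
  ... | inj₁ _ | inj₁ _ | inj₁ _ | inj₂ sat = ++⁺ʳ ws (++⁺ʳ xs (++⁺ʳ ys
    ([ ++⁺ˡ , ++⁺ʳ zs ∘ there ∘ ++⁺ʳ ws′ ∘ ++⁺ʳ xs′ ∘ ++⁺ʳ ys′ ]′ (++⁻ zs sat))))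

  Any-contract : ∀ xs ys {zs} → Any P (xs ++ ys ++ ys ++ zs) → Any P (xs ++ ys ++ zs)
  Any-contract xs ys = [ ++⁺ˡ , ++⁺ʳ xs ∘ [ ++⁺ˡ , id ]′ ∘ ++⁻ ys ]′ ∘ ++⁻ xs

  Any-exchange : ∀ xs ys zs {ws} → Any P (xs ++ ys ++ zs ++ ws) → Any P (xs ++ zs ++ ys ++ ws)
  Any-exchange xs ys zs = ↭.Any-resp-↭ (↭.++⁺ˡ xs (↭.shifts ys zs))

InClass : Logic → PDBAO → Set
InClass MPDBL  _ = Unit
InClass MPDBL4 A = Topological A

module Soundness {A : PDBAO} (v : Valuation A) where
  open PDBAO A
  open Order A
  open Valuation v
  open IsEquivalence isEquivalence

  axiom-sound : ∀ {L α β} → InClass L A → Axiom L α β → ⟦ v ⟧ α ⊑ ⟦ v ⟧ β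
  axiom-sound _ refl-ax = ⊑-refl
  axiom-sound _ ⊓-l = ⊓-lowerˡ _ _
  axiom-sound _ ⊓-r = ⊓-lowerʳ _ _
  axiom-sound _ ⊔-l = ⊔-upperˡ _ _
  axiom-sound _ ⊔-r = ⊔-upperʳ _ _
  axiom-sound _ ⊓-dup = ≈⇒⊑ (sym (⊓∈D⊓ _ _))
  axiom-sound _ ⊔-dup = ≈⇒⊑ (⊔∈D⊔ _ _)
  axiom-sound _ ¬-dup = ≈⇒⊑ (¬-idem _)
  axiom-sound _ ⌟-dup = ≈⇒⊑ (sym (⌟-idem _))
  axiom-sound _ ⊓¬ = ≈⇒⊑ (⊓-¬ _)
  axiom-sound _ ⊔⌟ = ≈⇒⊑ (sym (⊔-⌟ _))
  axiom-sound _ ¬¬₁ = ≈⇒⊑ (¬¬ _ _)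
  axiom-sound _ ¬¬₂ = ≈⇒⊑ (sym (¬¬ _ _))
  axiom-sound _ ⌟⌟₁ = ≈⇒⊑ (⌟⌟ _ _)
  axiom-sound _ ⌟⌟₂ = ≈⇒⊑ (sym (⌟⌟ _ _))
  axiom-sound _ abs₁ = ≈⇒⊑ (sym (abs-⊓⊔ _ _))
  axiom-sound _ abs₂ = ≈⇒⊑ (abs-⊔⊓ _ _)
  axiom-sound _ abs₃ = ≈⇒⊑ (sym (abs-⊓∨ _ _))
  axiom-sound _ abs₄ = ≈⇒⊑ (abs-⊔∧ _ _)
  axiom-sound _ dist₁ = ≈⇒⊑ (dist-⊓∨ _ _ _)
  axiom-sound _ dist₂ = ≈⇒⊑ (sym (dist-⊓∨ _ _ _))
  axiom-sound _ dist₃ = ≈⇒⊑ (dist-⊔∧ _ _ _)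
  axiom-sound _ dist₄ = ≈⇒⊑ (sym (dist-⊔∧ _ _ _))
  axiom-sound _ ⊥-ax = ⊥-least _
  axiom-sound _ ⊤-ax = ⊤-greatest _
  axiom-sound _ ax-¬⊤ = ≈⇒⊑ ¬⊤
  axiom-sound _ ax-⌟⊥ = ≈⇒⊑ (sym ⌟⊥)
  axiom-sound _ ¬⊥₁ = ≈⇒⊑ ¬⊥
  axiom-sound _ ¬⊥₂ = ≈⇒⊑ (sym ¬⊥)
  axiom-sound _ ⌟⊤₁ = ≈⇒⊑ ⌟⊤
  axiom-sound _ ⌟⊤₂ = ≈⇒⊑ (sym ⌟⊤)
  axiom-sound _ mix₁ = ≈⇒⊑ (sym (⊓⊔-mix _))
  axiom-sound _ mix₂ = ≈⇒⊑ (⊓⊔-mix _)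
  axiom-sound _ ov₁ = ≈⇒⊑ (vo-⊓ _)
  axiom-sound _ ov₂ = ≈⇒⊑ (sym (vo-⊓ _))
  axiom-sound _ pv₁ = ≈⇒⊑ (vp-⊔ _)
  axiom-sound _ pv₂ = ≈⇒⊑ (sym (vp-⊔ _))
  axiom-sound _ □⊓₁ = ≈⇒⊑ (sym (𝐈-⊓ _ _))
  axiom-sound _ □⊓₂ = ≈⇒⊑ (𝐈-⊓ _ _)
  axiom-sound _ ■⊔₁ = ≈⇒⊑ (sym (𝐂-⊔ _ _))
  axiom-sound _ ■⊔₂ = ≈⇒⊑ (𝐂-⊔ _ _)
  axiom-sound _ □¬⊥₁ = ≈⇒⊑ 𝐈-¬⊥
  axiom-sound _ □¬⊥₂ = ≈⇒⊑ (sym 𝐈-¬⊥)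
  axiom-sound _ ■⌟⊤₁ = ≈⇒⊑ 𝐂-⌟⊤
  axiom-sound _ ■⌟⊤₂ = ≈⇒⊑ (sym 𝐂-⌟⊤)
  axiom-sound _ □dup₁ = ≈⇒⊑ (𝐈-dup _)
  axiom-sound _ □dup₂ = ≈⇒⊑ (sym (𝐈-dup _))
  axiom-sound _ ■dup₁ = ≈⇒⊑ (𝐂-dup _)
  axiom-sound _ ■dup₂ = ≈⇒⊑ (sym (𝐂-dup _))
  axiom-sound top □T = Topological.𝐈-defl top _
  axiom-sound top ■T = Topological.𝐂-infl top _
  axiom-sound top □4₁ = ≈⇒⊑ (Topological.𝐈𝐈 top _)
  axiom-sound top □4₂ = ≈⇒⊑ (sym (Topological.𝐈𝐈 top _))
  axiom-sound top ■4₁ = ≈⇒⊑ (Topological.𝐂𝐂 top _)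
  axiom-sound top ■4₂ = ≈⇒⊑ (sym (Topological.𝐂𝐂 top _))

  sound : ∀ {L H} → InClass L A → Prov L H → SatHS v H
  sound c (ax a) = here (axiom-sound c a)
  sound c (sp {α}) with pure (⟦ v ⟧ α)
  ... | inj₁ α∈D⊓ = here (≈⇒⊑ (sym α∈D⊓))
  ... | inj₂ α∈D⊔ = there (here (≈⇒⊑ α∈D⊔))
  sound c (⊓R {B} p) = Any-replace B (λ α⊑β → ⊓-mono α⊑β ⊑-refl) (sound c p)
  sound c (⊓L {B} p) = Any-replace B (⊓-mono ⊑-refl) (sound c p)
  sound c (⊔R {B} p) = Any-replace B (λ α⊑β → ⊔-mono α⊑β ⊑-refl) (sound c p)
  sound c (⊔L {B} p) = Any-replace B (⊔-mono ⊑-refl) (sound c p)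
  sound c (¬R {B} p) = Any-replace B ¬-antitone (sound c p)
  sound c (⌟R {B} p) = Any-replace B ⌟-antitone (sound c p)
  sound c (□R {B} p) = Any-replace B 𝐈-mono (sound c p)
  sound c (■R {B} p) = Any-replace B 𝐂-mono (sound c p)
  sound c (cut {B} {D = D} p q) = Any-cut B D ⊑-trans (sound c p) (sound c q)
  sound c (antisym {B} {D = D} {F = F} {H = H} p₁ p₂ p₃ p₄) =
    Any-cut₄ B D F H ⊑-antisym-rule (sound c p₁) (sound c p₂) (sound c p₃) (sound c p₄)
  sound c (ec {B} {D = D} p) = Any-contract B D (sound c p)
  sound c (ee {B} {D = D} {E} p) = Any-exchange B D E (sound c p)
  sound c (ew p) = ++⁺ˡ (sound c p)

soundness : ∀ {L H} → Prov L H → (A : PDBAO) → InClass L A → TrueIn A H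
soundness p A c v = Soundness.sound v c p

module Lindenbaum (L : Logic) where

  infix 4 _⊩_ _⊣⊩_ _⊑ᴸ_
  infixr 5 _⨾_

  _⊩_ : Fm → Fm → Set
  α ⊩ β = Prov L [ α ⊢ β ]

  _⨾_ : ∀ {α β γ} → α ⊩ β → β ⊩ γ → α ⊩ γ
  p ⨾ q = cut {B = []} {C = []} {D = []} {E = []} p q

  mono-⊓ˡ : ∀ {α β γ} → α ⊩ β → α ⊓ᶠ γ ⊩ β ⊓ᶠ γ
  mono-⊓ˡ = ⊓R {B = []} {C = []}

  mono-⊓ʳ : ∀ {α β γ} → α ⊩ β → γ ⊓ᶠ α ⊩ γ ⊓ᶠ β
  mono-⊓ʳ = ⊓L {B = []} {C = []}

  mono-⊔ˡ : ∀ {α β γ} → α ⊩ β → α ⊔ᶠ γ ⊩ β ⊔ᶠ γ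
  mono-⊔ˡ = ⊔R {B = []} {C = []}

  mono-⊔ʳ : ∀ {α β γ} → α ⊩ β → γ ⊔ᶠ α ⊩ γ ⊔ᶠ β
  mono-⊔ʳ = ⊔L {B = []} {C = []}

  anti-¬ : ∀ {α β} → α ⊩ β → ¬ᶠ β ⊩ ¬ᶠ α
  anti-¬ = ¬R {B = []} {C = []}

  anti-⌟ : ∀ {α β} → α ⊩ β → ⌟ᶠ β ⊩ ⌟ᶠ α
  anti-⌟ = ⌟R {B = []} {C = []}

  mono-□ : ∀ {α β} → α ⊩ β → □ α ⊩ □ β
  mono-□ = □R {B = []} {C = []}

  mono-■ : ∀ {α β} → α ⊩ β → ■ α ⊩ ■ β
  mono-■ = ■R {B = []} {C = []}

  ⊓-intro : ∀ {γ α β} → γ ⊩ γ ⊓ᶠ γ → γ ⊩ α → γ ⊩ β → γ ⊩ α ⊓ᶠ β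
  ⊓-intro γ⊩γ⊓γ p q = γ⊩γ⊓γ ⨾ mono-⊓ˡ p ⨾ mono-⊓ʳ q

  ⊔-elim : ∀ {γ α β} → γ ⊔ᶠ γ ⊩ γ → α ⊩ γ → β ⊩ γ → α ⊔ᶠ β ⊩ γ
  ⊔-elim γ⊔γ⊩γ p q = (mono-⊔ˡ p ⨾ mono-⊔ʳ q) ⨾ γ⊔γ⊩γ

  ⊓-dupᴸ : ∀ {α β} → α ⊓ᶠ β ⊩ (α ⊓ᶠ β) ⊓ᶠ (α ⊓ᶠ β)
  ⊓-dupᴸ = ax ⊓-dup

  ⊔-dupᴸ : ∀ {α β} → (α ⊔ᶠ β) ⊔ᶠ (α ⊔ᶠ β) ⊩ α ⊔ᶠ β
  ⊔-dupᴸ = ax ⊔-dup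

  ¬¬⊩⊓ : ∀ {α} → ¬ᶠ (¬ᶠ α) ⊩ α ⊓ᶠ α
  ¬¬⊩⊓ = anti-¬ (ax ¬-dup) ⨾ ax ¬¬₁

  ⊔⊩⌟⌟ : ∀ {α} → α ⊔ᶠ α ⊩ ⌟ᶠ (⌟ᶠ α)
  ⊔⊩⌟⌟ = ax ⌟⌟₂ ⨾ anti-⌟ (ax ⌟-dup)

  -- Pass through ¬(α ⊓ α) ⊣⊢ ¬¬¬(α ⊓ α), to which ¬¬β ⊢ β ⊓ β applies.
  ¬-dupᴸ : ∀ {α} → ¬ᶠ α ⊩ ¬ᶠ α ⊓ᶠ ¬ᶠ α
  ¬-dupᴸ = anti-¬ (ax ⊓-l) ⨾ anti-¬ (ax ¬¬₁) ⨾ ¬¬⊩⊓ ⨾ mono-⊓ˡ (ax ¬-dup) ⨾ mono-⊓ʳ (ax ¬-dup)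

  ⌟-dupᴸ : ∀ {α} → ⌟ᶠ α ⊔ᶠ ⌟ᶠ α ⊩ ⌟ᶠ α
  ⌟-dupᴸ = (mono-⊔ˡ (ax ⌟-dup) ⨾ mono-⊔ʳ (ax ⌟-dup)) ⨾ ⊔⊩⌟⌟ ⨾ anti-⌟ (ax ⌟⌟₂) ⨾ anti-⌟ (ax ⊔-l)

  Fm-pure : ∀ α → α ⊩ α ⊓ᶠ α ⊎ α ⊔ᶠ α ⊩ α
  Fm-pure (ov _) = inj₁ (ax ov₂)
  Fm-pure (pv _) = inj₂ (ax pv₁)
  Fm-pure ⊤ᶠ = inj₂ (ax ⊤-ax)
  Fm-pure ⊥ᶠ = inj₁ (ax ⊥-ax)
  Fm-pure (_ ⊓ᶠ _) = inj₁ ⊓-dupᴸ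
  Fm-pure (_ ⊔ᶠ _) = inj₂ ⊔-dupᴸ
  Fm-pure (¬ᶠ _) = inj₁ ¬-dupᴸ
  Fm-pure (⌟ᶠ _) = inj₂ ⌟-dupᴸ
  Fm-pure (□ _) = inj₁ (ax □dup₂ ⨾ ax □⊓₂)
  Fm-pure (■ _) = inj₂ (ax ■⊔₁ ⨾ ax ■dup₁)

  _⊣⊩_ : Fm → Fm → Set
  α ⊣⊩ β = α ⊩ β × β ⊩ α

  ⊣⊩-isEquivalence : IsEquivalence _⊣⊩_
  ⊣⊩-isEquivalence = record
    { refl = ax refl-ax , ax refl-ax
    ; sym = swap
    ; trans = λ (p , q) (p′ , q′) → p ⨾ p′ , q′ ⨾ q
    }

  _⊑ᴸ_ : Fm → Fm → Set
  α ⊑ᴸ β = (α ⊓ᶠ β ⊣⊩ α ⊓ᶠ α) × (α ⊔ᶠ β ⊣⊩ β ⊔ᶠ β)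

  ⊩⇒⊑ᴸ : ∀ {α β} → α ⊩ β → α ⊑ᴸ β
  ⊩⇒⊑ᴸ p = (⊓-intro ⊓-dupᴸ (ax ⊓-l) (ax ⊓-l) , mono-⊓ʳ p) ,
           (mono-⊔ˡ p , ⊔-elim ⊔-dupᴸ (ax ⊔-r) (ax ⊔-r))

  ⊑ᴸ⇒⊩ : ∀ {α β} → α ⊑ᴸ β → α ⊩ β
  ⊑ᴸ⇒⊩ ((p₁ , p₂) , (p₃ , p₄)) =
    antisym {B = []} {C = []} {D = []} {E = []} {F = []} {G = []} {H = []} {X = []} p₁ p₂ p₃ p₄

  algebra : PDBAO
  algebra = record
    { Carrier = Fm
    ; _≈_ = _⊣⊩_
    ; isEquivalence = ⊣⊩-isEquivalence
    ; _⊓_ = _⊓ᶠ_ ; _⊔_ = _⊔ᶠ_ ; ¬_ = ¬ᶠ ; ⌟_ = ⌟ᶠ ; ⊤ = ⊤ᶠ ; ⊥ = ⊥ᶠ ; 𝐈 = □ ; 𝐂 = ■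
    ; ⊓-cong = λ (p , p′) (q , q′) → mono-⊓ˡ p ⨾ mono-⊓ʳ q , mono-⊓ˡ p′ ⨾ mono-⊓ʳ q′
    ; ⊔-cong = λ (p , p′) (q , q′) → mono-⊔ˡ p ⨾ mono-⊔ʳ q , mono-⊔ˡ p′ ⨾ mono-⊔ʳ q′
    ; ¬-cong = λ (p , p′) → anti-¬ p′ , anti-¬ p
    ; ⌟-cong = λ (p , p′) → anti-⌟ p′ , anti-⌟ p
    ; 𝐈-cong = λ (p , p′) → mono-□ p , mono-□ p′
    ; 𝐂-cong = λ (p , p′) → mono-■ p , mono-■ p′
    ; ⊓-idem-l = λ _ _ →
        mono-⊓ˡ (ax ⊓-l) , ⊓-intro ⊓-dupᴸ (⊓-intro ⊓-dupᴸ (ax ⊓-l) (ax ⊓-l)) (ax ⊓-r)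
    ; ⊔-idem-l = λ _ _ →
        ⊔-elim ⊔-dupᴸ (⊔-elim ⊔-dupᴸ (ax ⊔-l) (ax ⊔-l)) (ax ⊔-r) , mono-⊔ˡ (ax ⊔-l)
    ; ⊓-comm = λ _ _ → ⊓-swap , ⊓-swap
    ; ⊔-comm = λ _ _ → ⊔-swap , ⊔-swap
    ; ⊓-assoc = λ _ _ _ →
        ⊓-intro ⊓-dupᴸ (ax ⊓-l ⨾ ax ⊓-l) (⊓-intro ⊓-dupᴸ (ax ⊓-l ⨾ ax ⊓-r) (ax ⊓-r)) ,
        ⊓-intro ⊓-dupᴸ (⊓-intro ⊓-dupᴸ (ax ⊓-l) (ax ⊓-r ⨾ ax ⊓-l)) (ax ⊓-r ⨾ ax ⊓-r)
    ; ⊔-assoc = λ _ _ _ →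
        ⊔-elim ⊔-dupᴸ (⊔-elim ⊔-dupᴸ (ax ⊔-l) (ax ⊔-l ⨾ ax ⊔-r)) (ax ⊔-r ⨾ ax ⊔-r) ,
        ⊔-elim ⊔-dupᴸ (ax ⊔-l ⨾ ax ⊔-l) (⊔-elim ⊔-dupᴸ (ax ⊔-r ⨾ ax ⊔-l) (ax ⊔-r))
    ; ¬-idem = λ _ → ax ¬-dup , anti-¬ (ax ⊓-l)
    ; ⌟-idem = λ _ → anti-⌟ (ax ⊔-l) , ax ⌟-dup
    ; abs-⊓⊔ = λ _ _ → ⊓-intro ⊓-dupᴸ (ax ⊓-l) (ax ⊓-l) , ax abs₁
    ; abs-⊔⊓ = λ _ _ → ax abs₂ , ⊔-elim ⊔-dupᴸ (ax ⊔-l) (ax ⊔-l)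
    ; dist-⊓∨ = λ _ _ _ → ax dist₁ , ax dist₂
    ; dist-⊔∧ = λ _ _ _ → ax dist₃ , ax dist₄
    ; abs-⊓∨ = λ _ _ → ⊓-intro ⊓-dupᴸ (ax ⊓-l) (ax ⊓-l) , ax abs₃
    ; abs-⊔∧ = λ _ _ → ax abs₄ , ⊔-elim ⊔-dupᴸ (ax ⊔-l) (ax ⊔-l)
    ; ¬¬ = λ _ _ → ax ¬¬₁ , ax ¬¬₂
    ; ⌟⌟ = λ _ _ → ax ⌟⌟₁ , ax ⌟⌟₂
    ; ⊓-¬ = λ _ → ax ⊓¬ , ax ⊥-ax
    ; ⊔-⌟ = λ _ → ax ⊤-ax , ax ⊔⌟
    ; ¬⊥ = ax ¬⊥₁ , ax ¬⊥₂
    ; ⌟⊤ = ax ⌟⊤₁ , ax ⌟⊤₂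
    ; ¬⊤ = ax ax-¬⊤ , ax ⊥-ax
    ; ⌟⊥ = ax ⊤-ax , ax ax-⌟⊥
    ; ⊓⊔-mix = λ _ → ax mix₂ , ax mix₁
    ; pure = λ α → Sum.map (ax ⊓-l ,_) (_, ax ⊔-l) (Fm-pure α)
    ; 𝐈-mono = ⊩⇒⊑ᴸ ∘ mono-□ ∘ ⊑ᴸ⇒⊩
    ; 𝐂-mono = ⊩⇒⊑ᴸ ∘ mono-■ ∘ ⊑ᴸ⇒⊩
    ; 𝐈-⊓ = λ _ _ → ax □⊓₂ , ax □⊓₁
    ; 𝐂-⊔ = λ _ _ → ax ■⊔₂ , ax ■⊔₁
    ; 𝐈-¬⊥ = ax □¬⊥₁ , ax □¬⊥₂
    ; 𝐂-⌟⊤ = ax ■⌟⊤₁ , ax ■⌟⊤₂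
    ; 𝐈-dup = λ _ → ax □dup₁ , ax □dup₂
    ; 𝐂-dup = λ _ → ax ■dup₁ , ax ■dup₂
    }
    where
    ⊓-swap : ∀ {α β} → α ⊓ᶠ β ⊩ β ⊓ᶠ α
    ⊓-swap = ⊓-intro ⊓-dupᴸ (ax ⊓-r) (ax ⊓-l)

    ⊔-swap : ∀ {α β} → α ⊔ᶠ β ⊩ β ⊔ᶠ α
    ⊔-swap = ⊔-elim ⊔-dupᴸ (ax ⊔-r) (ax ⊔-l)

  canonical : Valuation algebra
  canonical = record
    { vo = ov ; vp = pv
    ; vo-⊓ = λ _ → ax ov₁ , ax ov₂
    ; vp-⊔ = λ _ → ax pv₁ , ax pv₂
    }

  ⟦⟧-canonical : ∀ α → ⟦ canonical ⟧ α ≡ α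
  ⟦⟧-canonical (ov _) = _≡_.refl
  ⟦⟧-canonical (pv _) = _≡_.refl
  ⟦⟧-canonical ⊤ᶠ = _≡_.refl
  ⟦⟧-canonical ⊥ᶠ = _≡_.refl
  ⟦⟧-canonical (α ⊓ᶠ β) = cong₂ _⊓ᶠ_ (⟦⟧-canonical α) (⟦⟧-canonical β)
  ⟦⟧-canonical (α ⊔ᶠ β) = cong₂ _⊔ᶠ_ (⟦⟧-canonical α) (⟦⟧-canonical β)
  ⟦⟧-canonical (¬ᶠ α) = cong ¬ᶠ (⟦⟧-canonical α)
  ⟦⟧-canonical (⌟ᶠ α) = cong ⌟ᶠ (⟦⟧-canonical α)
  ⟦⟧-canonical (□ α) = cong □ (⟦⟧-canonical α)
  ⟦⟧-canonical (■ α) = cong ■ (⟦⟧-canonical α)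

  canonical-sat⇒⊩ : ∀ {α β} → SatSeq canonical (α ⊢ β) → α ⊩ β
  canonical-sat⇒⊩ {α} {β} = ⊑ᴸ⇒⊩ ∘ subst₂ _⊑ᴸ_ (⟦⟧-canonical α) (⟦⟧-canonical β)

  weakenˡ : ∀ K {H} → Prov L H → Prov L (K ++ H)
  weakenˡ K {H} p =
    subst (Prov L) (cong (K ++_) (++-identityʳ H))
      (ee {B = []} {C = []} {D = H} {E = K} (ew {B = H} {C = K ++ []} p))

  component⇒Prov : ∀ {H} → Any (λ s → Prov L [ s ]) H → Prov L H
  component⇒Prov (here p) = ew p
  component⇒Prov (there {x = s} sat) = weakenˡ [ s ] (component⇒Prov sat)

  canonical-sat⇒Prov : ∀ {H} → SatHS canonical H → Prov L H
  canonical-sat⇒Prov = component⇒Prov ∘ Any.map canonical-sat⇒⊩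

Lindenbaum-InClass : ∀ L → InClass L (Lindenbaum.algebra L)
Lindenbaum-InClass MPDBL = unit
Lindenbaum-InClass MPDBL4 = record
  { 𝐈-defl = λ _ → ⊩⇒⊑ᴸ (ax □T)
  ; 𝐂-infl = λ _ → ⊩⇒⊑ᴸ (ax ■T)
  ; 𝐈𝐈 = λ _ → ax □4₁ , ax □4₂
  ; 𝐂𝐂 = λ _ → ax ■4₁ , ax ■4₂
  }
  where open Lindenbaum MPDBL4

completeness : ∀ {L H} → ((A : PDBAO) → InClass L A → TrueIn A H) → Prov L H
completeness {L} valid =
  canonical-sat⇒Prov (valid algebra (Lindenbaum-InClass L) canonical)
  where open Lindenbaum L

theorem54 : ((H : HS) → Prov MPDBL H ⇔ ValidPDBAO H)
            × ((H : HS) → Prov MPDBL4 H ⇔ ValidTPDBA H)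
theorem54 =
  (λ _ → mk⇔ (λ p A → soundness p A unit) (λ valid → completeness (λ A _ → valid A))) ,
  (λ _ → mk⇔ soundness completeness)
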